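{- Let $A$ be a set and let $\to_{\mathsf e\alpha},\to_{\mathsf i\alpha},\to_{\mathsf e\gamma},\to_{\mathsf i\gamma}$ be binary relations on $A$. Put $\to_\alpha := \to_{\mathsf e\alpha}\cup\to_{\mathsf i\alpha}$, $\to_\gamma := \to_{\mathsf e\gamma}\cup\to_{\mathsf i\gamma}$, $\to_{\mathsf e} := \to_{\mathsf e\alpha}\cup\to_{\mathsf e\gamma}$ and $\to_{\mathsf i} := \to_{\mathsf i\alpha}\cup\to_{\mathsf i\gamma}$. Assume that $\to_\alpha$ is $\mathsf e$-factorizing, i.e. $(\to_{\mathsf e\alpha}\cup\to_{\mathsf i\alpha})^*\subseteq \to_{\mathsf e\alpha}^*\cdot\to_{\mathsf i\alpha}^*$, and that $\to_\gamma$ is $\mathsf e$-factorizing, i.e. $(\to_{\mathsf e\gamma}\cup\to_{\mathsf i\gamma})^*\subseteq \to_{\mathsf e\gamma}^*\cdot\to_{\mathsf i\gamma}^*$. Assume moreover the two linear swap conditions $$\to_{\mathsf i\alpha}\cdot\to_{\mathsf e\gamma}\ \subseteq\ \to_{\mathsf e\gamma}\cdot\to_\alpha^* \qquad\text{and}\qquad \to_{\mathsf i\gamma}\cdot\to_{\mathsf e\alpha}\ \subseteq\ \to_{\mathsf e\alpha}\cdot\to_\gamma^*.$$ Then $\to_\alpha\cup\to_\gamma$ satisfies $\mathsf e$-factorization: $(\to_{\mathsf e}\cup\to_{\mathsf i})^*\subseteq \to_{\mathsf e}^*\cdot\to_{\mathsf i}^*$.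
   Context: For a binary relation $\to$ on $A$, $\to^*$ denotes its reflexive-transitive closure. For relations $R,S$ on $A$, $R\cdot S$ is their composition: $t\,(R\cdot S)\,s$ iff there is $u\in A$ with $t\,R\,u$ and $u\,S\,s$. -}

module Defs where

open import Level using (Level; _⊔_)
open import Relation.Binary.Core using (Rel; _⇒_)
open import Relation.Binary.Construct.Closure.ReflexiveTransitive using (Star)
open import Relation.Binary.Construct.Union using (_∪_)
open import Data.Product using (∃; _×_)

infixr 9 _·_
_·_ : ∀ {a ℓ₁ ℓ₂} {A : Set a} → Rel A ℓ₁ → Rel A ℓ₂ → Rel A (a ⊔ ℓ₁ ⊔ ℓ₂)
R · S = λ t s → ∃ λ u → R t u × S u s

EFactorizing : ∀ {a ℓ} {A : Set a} → Rel A ℓ → Rel A ℓ → Set (a ⊔ ℓ)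
EFactorizing e i = Star (e ∪ i) ⇒ (Star e · Star i)

module Submission where

-- Idea: a reduction sequence of  →e ∪ →i  factorizes as  →e* · →i*  as soon
-- as every single i-step can be postponed after any sequence of e-steps,
-- i.e.  →i · →e* ⊆ →e* · →i*  (lemma factorizing-by-postponement, by
-- induction on the sequence).  So for the combined system it suffices to
-- postpone one  →iα-step  (and, symmetrically, one  →iγ-step) past a
-- sequence of  →eα ∪ →eγ  steps.

open import Defs
open import Relation.Binary.Core using (Rel; _⇒_)
open import Relation.Binary.Construct.Closure.ReflexiveTransitive
  using (Star; ε; _◅_; _◅◅_; map)
open import Relation.Binary.Construct.Union using (_∪_)
open import Data.Sum using (inj₁; inj₂; swap)
open import Data.Product using (_,_)

factorizing-by-postponement : ∀ {a ℓ} {A : Set a} {e i : Rel A ℓ} →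
  (i · Star e) ⇒ (Star e · Star i) → EFactorizing e i
factorizing-by-postponement postpone ε = _ , ε , ε
factorizing-by-postponement postpone (inj₁ e ◅ steps)
  with factorizing-by-postponement postpone steps
... | _ , es , is = _ , e ◅ es , is
factorizing-by-postponement postpone (inj₂ i ◅ steps)
  with factorizing-by-postponement postpone steps
... | _ , es , is with postpone (_ , i , es)
... | _ , es′ , is′ = _ , es′ , is′ ◅◅ is

module Postponement {a ℓ} {A : Set a} (eX iX eY : Rel A ℓ)
  (factorizingX : EFactorizing eX iX)
  (linearSwap : (iX · eY) ⇒ (eY · Star (eX ∪ iX))) where

  X : Rel A ℓ
  X = eX ∪ iX

  E : Rel A ℓ
  E = eX ∪ eY

  iX*-swap : (Star iX · eY) ⇒ (eY · Star X)
  iX*-swap (_ , ε , ey) = _ , ey , ε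
  iX*-swap (_ , i ◅ is , ey) with iX*-swap (_ , is , ey)
  ... | _ , ey′ , xs with linearSwap (_ , i , ey′)
  ... | _ , ey″ , xs′ = _ , ey″ , xs′ ◅◅ xs

  -- →X* · →E ⊆ →E* · →X*.  An eX-step is simply absorbed into →X*; before an
  -- eY-step, factorize →X* as →eX* · →iX* and swap the →iX* part.
  X*-swap-E : (Star X · E) ⇒ (Star E · Star X)
  X*-swap-E (_ , xs , inj₁ ex) = _ , ε , xs ◅◅ inj₁ ex ◅ ε
  X*-swap-E (_ , xs , inj₂ ey) with factorizingX xs
  ... | _ , exs , is with iX*-swap (_ , is , ey)
  ... | _ , ey′ , xs′ = _ , map inj₁ exs ◅◅ inj₂ ey′ ◅ ε , xs′

  -- →X* · →E* ⊆ →E* · →X*, by iterating X*-swap-E along the E-sequence.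
  -- (The recursion runs on the E-sequence alone, so it is done curried.)
  X*-swap-E* : (Star X · Star E) ⇒ (Star E · Star X)
  X*-swap-E* (_ , xs , es) = along es xs
    where
    along : ∀ {y z} → Star E y z → ∀ {x} → Star X x y → (Star E · Star X) x z
    along ε xs = _ , ε , xs
    along (e ◅ es) xs with X*-swap-E (_ , xs , e)
    ... | _ , es₁ , xs₁ with along es xs₁
    ... | _ , es₂ , xs₂ = _ , es₁ ◅◅ es₂ , xs₂

  -- →iX · →E* ⊆ →E* · →iX*: push the iX-step (as an X-sequence) past →E*,
  -- then e-factorize what remains and merge its eX-part into the E-sequence.
  postpone-iX : (iX · Star E) ⇒ (Star E · Star iX)
  postpone-iX (_ , i , es) with X*-swap-E* (_ , inj₂ i ◅ ε , es)
  ... | _ , es′ , xs with factorizingX xs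
  ... | _ , exs , is = _ , es′ ◅◅ map inj₁ exs , is

theorem3p4 : ∀ {a ℓ} {A : Set a} (eα iα eγ iγ : Rel A ℓ) →
    EFactorizing eα iα →
    EFactorizing eγ iγ →
    (iα · eγ) ⇒ (eγ · Star (eα ∪ iα)) →
    (iγ · eα) ⇒ (eα · Star (eγ ∪ iγ)) →
    EFactorizing (eα ∪ eγ) (iα ∪ iγ)
theorem3p4 eα iα eγ iγ factorizingα factorizingγ swapα swapγ =
  factorizing-by-postponement postpone
  where
  module α = Postponement eα iα eγ factorizingα swapα
  module γ = Postponement eγ iγ eα factorizingγ swapγ

  postpone : ((iα ∪ iγ) · Star (eα ∪ eγ)) ⇒ (Star (eα ∪ eγ) · Star (iα ∪ iγ))
  postpone (_ , inj₁ i , es) with α.postpone-iX (_ , i , es)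
  ... | _ , es′ , is = _ , es′ , map inj₁ is
  postpone (_ , inj₂ i , es) with γ.postpone-iX (_ , i , map swap es)
  ... | _ , es′ , is = _ , map swap es′ , map inj₂ is
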